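{- Let $G$ be a simple graph of order $n>2$ with $m$ edges, whose vertex degrees are ordered as $d_1\ge d_2\ge\cdots\ge d_n$. Put $\Delta_1=d_1$, $\Delta_2=d_2$, and let $k$ ($2\le k\le n$) be the largest integer such that $d_2=d_3=\cdots=d_k=\Delta_2$. If $\Delta_2<\frac{2m}{n}$, then (i) $\Delta_1-\Delta_2>\sum_{i=3}^n(\Delta_2-d_i)$; (ii) $\Delta_2=d_3$; (iii) $\Delta_1>\Delta_2+n-k$; (iv) $k\ge \Delta_2+n+1-\Delta_1\ge \Delta_2+2$.
   Context: All graphs are finite and simple. $\Delta_1$ is the maximum degree and $\Delta_2$ the second largest entry of the non-increasing degree sequence. -}

module Defs where

open import Data.Nat using (ℕ; zero; suc; _+_; _<ᵇ_)
open import Data.Bool using (Bool; true; false; if_then_else_; _∧_)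
open import Data.Fin using (Fin; toℕ)
open import Data.List using (List; map; allFin)
open import Data.Nat.ListAction using (sum)
open import Relation.Binary.PropositionalEquality using (_≡_)

sumFin : (n : ℕ) → (Fin n → ℕ) → ℕ
sumFin n f = sum (map f (allFin n))

record Graph (n : ℕ) : Set where
  field
    adj    : Fin n → Fin n → Bool
    sym    : ∀ i j → adj i j ≡ adj j i
    irrefl : ∀ i → adj i i ≡ false

open Graph public

degree : {n : ℕ} → Graph n → Fin n → ℕ
degree {n} G v = sumFin n (λ u → if adj G v u then 1 else 0)

edges : {n : ℕ} → Graph n → ℕ
edges {n} G =
  sumFin n (λ i → sumFin n (λ j → if (toℕ i <ᵇ toℕ j) ∧ adj G i j then 1 else 0))

-- if2 j x = x when j ≥ 2 (0-based index, i.e. 1-based index ≥ 3), else 0;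
-- used to restrict a sum over Fin N to the indices 3..N (1-based).
if2 : ℕ → ℕ → ℕ
if2 zero x = 0
if2 (suc zero) x = 0
if2 (suc (suc _)) x = x

-- Double counting gives 2m = ∑ dᵢ = Δ₁ + (n − 1) Δ₂ − ∑_{i≥3} (Δ₂ − dᵢ), so the hypothesis
-- n Δ₂ < 2m says exactly that the deficits Δ₂ − dᵢ (i ≥ 3) sum to less than Δ₁ − Δ₂; this is (i).
-- Every index i > k contributes a deficit of at least 1, giving (iii), and (iv) is (iii)
-- rearranged together with Δ₁ ≤ n − 1. For (ii), k = 2 would force Δ₂ = 0 < Δ₁ by (iii);
-- but then a neighbour of a vertex of maximum degree has positive degree, yet degree ≤ Δ₂.
module Submission where

open import Defs hiding (sym)
open import Data.Nat using (ℕ; zero; suc; _+_; _*_; _∸_; _≤_; _<_; _<ᵇ_; z≤n; s≤s)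
open import Data.Nat.Properties
open import Data.Nat.Tactic.RingSolver using (solve-∀)
open import Data.Bool using (Bool; true; false; if_then_else_; _∧_; T)
open import Data.Bool.Properties using (T-≡)
open import Data.Fin using (Fin; toℕ; fromℕ<; zero; suc)
open import Data.Fin.Properties using (toℕ-injective; toℕ<n; toℕ-fromℕ<)
open import Data.Fin.Permutation using (permutation)
open import Data.List using (map; tabulate)
open import Data.List.Properties using (map-tabulate)
import Data.Nat.ListAction as List
open import Data.Vec.Functional using (removeAt)
open import Data.Product using (_×_; _,_; proj₁; proj₂; ∃-syntax)
open import Data.Sum using (inj₁; inj₂)
open import Data.Unit using (tt)
open import Function using (_∘_; id; Equivalence)
open import Function.Definitions using (Bijective)
open import Relation.Binary.Definitions using (tri<; tri≈; tri>)
open import Relation.Binary.PropositionalEquality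
open import Relation.Nullary using (¬_; yes; no; contradiction)
open import Algebra.Properties.CommutativeMonoid.Sum +-0-commutativeMonoid
  using (sum; sum-cong-≗; ∑-distrib-+; ∑-comm; sum-permute; sum-remove)

sumFin≡sum : ∀ n (f : Fin n → ℕ) → sumFin n f ≡ sum f
sumFin≡sum zero    f = refl
sumFin≡sum (suc n) f = cong (f zero +_) (begin
  List.sum (map f (tabulate suc))       ≡⟨ cong List.sum (map-tabulate suc f) ⟩
  List.sum (tabulate (f ∘ suc))         ≡⟨ cong List.sum (map-tabulate id (f ∘ suc)) ⟨
  sumFin n (f ∘ suc)                    ≡⟨ sumFin≡sum n (f ∘ suc) ⟩
  sum (f ∘ suc)                         ∎)
  where open ≡-Reasoning

sum-const : ∀ n c → sum {n} (λ _ → c) ≡ n * c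
sum-const zero    c = refl
sum-const (suc n) c = cong (c +_) (sum-const n c)

sum-≤-const : ∀ {n c} (f : Fin n → ℕ) → (∀ i → f i ≤ c) → sum f ≤ n * c
sum-≤-const {zero}  f f≤c = z≤n
sum-≤-const {suc n} f f≤c = +-mono-≤ (f≤c zero) (sum-≤-const (f ∘ suc) (f≤c ∘ suc))

≤-sum : ∀ {n} (f : Fin n → ℕ) i → f i ≤ sum f
≤-sum f zero    = m≤m+n _ _
≤-sum f (suc i) = ≤-trans (≤-sum (f ∘ suc) i) (m≤n+m _ _)

sum-positive : ∀ {n} (f : Fin n → ℕ) → 0 < sum f → ∃[ i ] 0 < f i
sum-positive {suc n} f 0<∑ with f zero in f₀≡
... | suc _ = zero , subst (0 <_) (sym f₀≡) (s≤s z≤n)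
... | zero  = let i , 0<fi = sum-positive (f ∘ suc) 0<∑ in suc i , 0<fi

sum-≥-tail : ∀ {n} k (f : Fin n → ℕ) → (∀ i → k ≤ toℕ i → 1 ≤ f i) → n ∸ k ≤ sum f
sum-≥-tail {zero}  k       f tail≥1 = ≤-reflexive (0∸n≡0 k)
sum-≥-tail {suc n} zero    f tail≥1 =
  +-mono-≤ (tail≥1 zero z≤n) (sum-≥-tail zero (f ∘ suc) (λ i _ → tail≥1 (suc i) z≤n))
sum-≥-tail {suc n} (suc k) f tail≥1 =
  ≤-trans (sum-≥-tail k (f ∘ suc) (λ i k≤i → tail≥1 (suc i) (s≤s k≤i))) (m≤n+m _ _)

sum-∘-bijective : ∀ {n} (f : Fin n → ℕ) (σ : Fin n → Fin n) → Bijective _≡_ _≡_ σ → sum (f ∘ σ) ≡ sum f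
sum-∘-bijective f σ (σ-injective , σ-surjective) = sym (sum-permute f π)
  where
  σ⁻¹ = λ y → proj₁ (σ-surjective y)
  π = permutation σ σ⁻¹ (λ y → proj₂ (σ-surjective y) refl) (λ x → σ-injective (proj₂ (σ-surjective (σ x)) refl))

indicator : Bool → ℕ
indicator x = if x then 1 else 0

indicator≤1 : ∀ x → indicator x ≤ 1
indicator≤1 true  = ≤-refl
indicator≤1 false = z≤n

indicator-positive : ∀ {x} → 0 < indicator x → x ≡ true
indicator-positive {true}  _ = refl
indicator-positive {false} ()

<ᵇ-true : ∀ {m n} → m < n → (m <ᵇ n) ≡ true
<ᵇ-true m<n = Equivalence.to T-≡ (<⇒<ᵇ m<n)

<ᵇ-false : ∀ {m n} → n ≤ m → (m <ᵇ n) ≡ false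
<ᵇ-false {m} {n} n≤m with m <ᵇ n in eq
... | false = refl
... | true  = contradiction (<ᵇ⇒< m n (subst T (sym eq) tt)) (≤⇒≯ n≤m)

module _ {n : ℕ} (G : Graph n) where

  forwardEdge : Fin n → Fin n → ℕ
  forwardEdge i j = indicator ((toℕ i <ᵇ toℕ j) ∧ adj G i j)

  adjacency-split : ∀ i j → indicator (adj G i j) ≡ forwardEdge i j + forwardEdge j i
  adjacency-split i j with <-cmp (toℕ i) (toℕ j)
  ... | tri< i<j _ _ rewrite <ᵇ-true i<j | <ᵇ-false (<⇒≤ i<j) = sym (+-identityʳ _)
  ... | tri> _ _ j<i rewrite <ᵇ-true j<i | <ᵇ-false (<⇒≤ j<i) = cong indicator (Graph.sym G i j)
  ... | tri≈ _ i≡j _ rewrite toℕ-injective i≡j | Graph.irrefl G j | <ᵇ-false (≤-refl {toℕ j}) = refl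

  handshake : sum (degree G) ≡ 2 * edges G
  handshake = begin
    sum (degree G)                                        ≡⟨ sum-cong-≗ (λ i → sumFin≡sum n (indicator ∘ adj G i)) ⟩
    sum (λ i → sum (λ j → indicator (adj G i j)))         ≡⟨ sum-cong-≗ (λ i → sum-cong-≗ (adjacency-split i)) ⟩
    sum (λ i → sum (λ j → forwardEdge i j + forwardEdge j i))
                                                          ≡⟨ sum-cong-≗ (λ i → ∑-distrib-+ (forwardEdge i) (λ j → forwardEdge j i)) ⟩
    sum (λ i → sum (forwardEdge i) + sum (λ j → forwardEdge j i))
                                                          ≡⟨ ∑-distrib-+ (sum ∘ forwardEdge) (λ i → sum (λ j → forwardEdge j i)) ⟩
    E + sum (λ i → sum (λ j → forwardEdge j i))           ≡⟨ cong (E +_) (∑-comm (λ i j → forwardEdge j i)) ⟩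
    E + E                                                 ≡⟨ cong (E +_) (+-identityʳ E) ⟨
    2 * E                                                 ≡⟨ cong (2 *_) edges≡E ⟨
    2 * edges G                                           ∎
    where
    open ≡-Reasoning
    E = sum (λ i → sum (forwardEdge i))
    edges≡E : edges G ≡ E
    edges≡E = trans (sumFin≡sum n _) (sum-cong-≗ (λ i → sumFin≡sum n (forwardEdge i)))

  adjacent⇒distinct : ∀ {u w} → adj G u w ≡ true → w ≢ u
  adjacent⇒distinct {u} aᵤᵤ refl = contradiction (trans (sym aᵤᵤ) (Graph.irrefl G u)) λ ()

  adjacent⇒positive-degree : ∀ {u w} → adj G u w ≡ true → 0 < degree G w
  adjacent⇒positive-degree {u} {w} aᵤw = subst (0 <_) (sym (sumFin≡sum n _))
    (≤-trans (≤-reflexive (cong indicator (sym (trans (Graph.sym G w u) aᵤw)))) (≤-sum _ u))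

  neighbour-of-positive-degree : ∀ u → 0 < degree G u → ∃[ w ] w ≢ u × 0 < degree G w
  neighbour-of-positive-degree u 0<deg =
    let w , 0<aᵤw = sum-positive aᵤ (subst (0 <_) (sumFin≡sum n aᵤ) 0<deg)
        aᵤw = indicator-positive 0<aᵤw
    in  w , adjacent⇒distinct aᵤw , adjacent⇒positive-degree aᵤw
    where aᵤ = λ w → indicator (adj G u w)

degree<order : ∀ {n} (G : Graph n) v → degree G v < n
degree<order {suc n} G v = s≤s (begin
  degree G v                            ≡⟨ sumFin≡sum (suc n) aᵥ ⟩
  sum aᵥ                                ≡⟨ sum-remove {i = v} aᵥ ⟩
  aᵥ v + sum (removeAt aᵥ v)            ≡⟨ cong (λ x → indicator x + sum (removeAt aᵥ v)) (Graph.irrefl G v) ⟩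
  sum (removeAt aᵥ v)                   ≤⟨ sum-≤-const (removeAt aᵥ v) (λ i → indicator≤1 (adj G v _)) ⟩
  n * 1                                 ≡⟨ *-identityʳ n ⟩
  n                                     ∎)
  where
  open ≤-Reasoning
  aᵥ = λ u → indicator (adj G v u)

sorted-second-degree-positive : ∀ {n} (G : Graph (2 + n)) (σ : Fin (2 + n) → Fin (2 + n))
  → Bijective _≡_ _≡_ σ
  → (∀ i j → toℕ i ≤ toℕ j → degree G (σ j) ≤ degree G (σ i))
  → 0 < degree G (σ zero) → 0 < degree G (σ (suc zero))
sorted-second-degree-positive G σ (_ , σ-surjective) non-increasing 0<Δ₁
  with neighbour-of-positive-degree G (σ zero) 0<Δ₁
... | w , w≢σ₀ , 0<deg-w with σ-surjective w
... | zero  , σ₀≡w = contradiction (sym (σ₀≡w refl)) w≢σ₀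
... | suc j , σⱼ≡w = <-≤-trans (subst (λ v → 0 < degree G v) (sym (σⱼ≡w refl)) 0<deg-w)
                                (non-increasing (suc zero) (suc j) (s≤s z≤n))

if2-≥2 : ∀ {t} x → 2 ≤ t → if2 t x ≡ x
if2-≥2 x (s≤s (s≤s _)) = refl

module NonIncreasingSequence {m : ℕ} (d : Fin (2 + m) → ℕ)
  (non-increasing : ∀ i j → toℕ i ≤ toℕ j → d j ≤ d i) where

  Δ₁ Δ₂ : ℕ
  Δ₁ = d zero
  Δ₂ = d (suc zero)

  deficit : Fin (2 + m) → ℕ
  deficit i = if2 (toℕ i) (Δ₂ ∸ d i)

  deficit+d≡Δ₂ : ∀ i → deficit (suc i) + d (suc i) ≡ Δ₂
  deficit+d≡Δ₂ zero    = refl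
  deficit+d≡Δ₂ (suc i) = m∸n+n≡m (non-increasing (suc zero) (suc (suc i)) (s≤s z≤n))

  sum-deficit+sum : sum deficit + sum d ≡ Δ₁ + suc m * Δ₂
  sum-deficit+sum = begin
    sum deficit + sum d                 ≡⟨ ∑-distrib-+ deficit d ⟨
    sum (λ i → deficit i + d i)         ≡⟨ cong (Δ₁ +_) (sum-cong-≗ deficit+d≡Δ₂) ⟩
    Δ₁ + sum {suc m} (λ _ → Δ₂)         ≡⟨ cong (Δ₁ +_) (sum-const (suc m) Δ₂) ⟩
    Δ₁ + suc m * Δ₂                     ∎
    where open ≡-Reasoning

  below-average⇒deficit-gap : (2 + m) * Δ₂ < sum d → sum deficit + Δ₂ < Δ₁
  below-average⇒deficit-gap below-average = +-cancelʳ-< (suc m * Δ₂) (sum deficit + Δ₂) Δ₁ (begin-strict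
    sum deficit + Δ₂ + suc m * Δ₂       ≡⟨ +-assoc (sum deficit) Δ₂ (suc m * Δ₂) ⟩
    sum deficit + (2 + m) * Δ₂          <⟨ +-monoʳ-< (sum deficit) below-average ⟩
    sum deficit + sum d                 ≡⟨ sum-deficit+sum ⟩
    Δ₁ + suc m * Δ₂                     ∎)
    where open ≤-Reasoning

  Plateau : ℕ → Set
  Plateau k = ∀ i → 1 ≤ toℕ i → toℕ i < k → d i ≡ Δ₂

  MaximalPlateau : ℕ → Set
  MaximalPlateau k = ∀ k′ → 2 ≤ k′ → k′ ≤ 2 + m → Plateau k′ → k′ ≤ k

  plateau-extend : ∀ {k} → Plateau k → (k<N : k < 2 + m) → d (fromℕ< k<N) ≡ Δ₂ → Plateau (suc k)
  plateau-extend plateau k<N dₖ≡Δ₂ i 1≤i i<1+k with m<1+n⇒m<n∨m≡n i<1+k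
  ... | inj₁ i<k = plateau i 1≤i i<k
  ... | inj₂ i≡k = subst (λ j → d j ≡ Δ₂) (toℕ-injective (trans (toℕ-fromℕ< k<N) (sym i≡k))) dₖ≡Δ₂

  beyond-maximal-plateau : ∀ {k} → 2 ≤ k → Plateau k → MaximalPlateau k → ∀ j → k ≤ toℕ j → d j < Δ₂
  beyond-maximal-plateau {k} 2≤k plateau maximal j k≤j =
    ≤-<-trans (non-increasing dₖ-index j (subst (_≤ toℕ j) (sym (toℕ-fromℕ< k<N)) k≤j)) dₖ<Δ₂
    where
    k<N = ≤-<-trans k≤j (toℕ<n j)
    dₖ-index = fromℕ< k<N
    dₖ≢Δ₂ : d dₖ-index ≢ Δ₂
    dₖ≢Δ₂ dₖ≡Δ₂ = 1+n≰n (maximal (suc k) (m≤n⇒m≤1+n 2≤k) k<N (plateau-extend plateau k<N dₖ≡Δ₂))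
    dₖ<Δ₂ : d dₖ-index < Δ₂
    dₖ<Δ₂ = ≤∧≢⇒< (non-increasing (suc zero) dₖ-index (subst (1 ≤_) (sym (toℕ-fromℕ< k<N)) (≤-trans (s≤s z≤n) 2≤k))) dₖ≢Δ₂

  tail-length≤sum-deficit : ∀ {k} → 2 ≤ k → Plateau k → MaximalPlateau k → 2 + m ∸ k ≤ sum deficit
  tail-length≤sum-deficit {k} 2≤k plateau maximal = sum-≥-tail k deficit λ j k≤j →
    subst (1 ≤_) (sym (if2-≥2 (Δ₂ ∸ d j) (≤-trans 2≤k k≤j)))
      (m<n⇒0<n∸m (beyond-maximal-plateau 2≤k plateau maximal j k≤j))

m+[n∸k]<o⇒m+n+1∸o≤k : ∀ {m n k o} → m + (n ∸ k) < o → k ≤ n → m + n + 1 ∸ o ≤ k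
m+[n∸k]<o⇒m+n+1∸o≤k {m} {n} {k} {o} m+[n∸k]<o k≤n = m≤n+o⇒m∸n≤o (m + n + 1) o (begin
  m + n + 1                   ≡⟨ cong (λ x → m + x + 1) (m∸n+n≡m k≤n) ⟨
  m + (n ∸ k + k) + 1         ≡⟨ shuffle m (n ∸ k) k ⟩
  suc (m + (n ∸ k)) + k       ≤⟨ +-monoˡ-≤ k m+[n∸k]<o ⟩
  o + k                       ∎)
  where
  open ≤-Reasoning
  shuffle : ∀ a b c → a + (b + c) + 1 ≡ suc (a + b) + c
  shuffle = solve-∀

o<n⇒m+2≤m+n+1∸o : ∀ {m n o} → o < n → m + 2 ≤ m + n + 1 ∸ o
o<n⇒m+2≤m+n+1∸o {m} {n} {o} o<n = m+n≤o⇒m≤o∸n (m + 2) (begin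
  m + 2 + o                   ≡⟨ shuffle m o ⟩
  m + suc o + 1               ≤⟨ +-monoˡ-≤ 1 (+-monoʳ-≤ m o<n) ⟩
  m + n + 1                   ∎)
  where
  open ≤-Reasoning
  shuffle : ∀ a b → a + 2 + b ≡ a + suc b + 1
  shuffle = solve-∀

plateau-length≥3 : ∀ {n} (G : Graph (3 + n)) (σ : Fin (3 + n) → Fin (3 + n))
  → Bijective _≡_ _≡_ σ
  → (∀ i j → toℕ i ≤ toℕ j → degree G (σ j) ≤ degree G (σ i))
  → ∀ {k} → 2 ≤ k → degree G (σ (suc zero)) + (3 + n ∸ k) < degree G (σ zero) → 3 ≤ k
plateau-length≥3 {n} G σ σ-bijective non-increasing {k} 2≤k Δ₂+[N∸k]<Δ₁ with 3 ≤? k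
... | yes 3≤k = 3≤k
... | no  3≰k = contradiction (sorted-second-degree-positive G σ σ-bijective non-increasing 0<Δ₁) ¬0<Δ₂
  where
  Δ₁ = degree G (σ zero)
  Δ₂ = degree G (σ (suc zero))
  Δ₂+[1+n]<Δ₁ : Δ₂ + suc n < Δ₁
  Δ₂+[1+n]<Δ₁ = subst (λ k → Δ₂ + (3 + n ∸ k) < Δ₁) (≤-antisym (≤-pred (≰⇒> 3≰k)) 2≤k) Δ₂+[N∸k]<Δ₁
  0<Δ₁ : 0 < Δ₁
  0<Δ₁ = ≤-<-trans z≤n Δ₂+[1+n]<Δ₁
  ¬0<Δ₂ : ¬ (0 < Δ₂)
  ¬0<Δ₂ 0<Δ₂ = <-irrefl refl (begin-strict
    2 + n           ≤⟨ +-monoˡ-≤ (suc n) 0<Δ₂ ⟩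
    Δ₂ + suc n      <⟨ Δ₂+[1+n]<Δ₁ ⟩
    Δ₁              ≤⟨ ≤-pred (degree<order G (σ zero)) ⟩
    2 + n           ∎)
    where open ≤-Reasoning

lemma3p1 : (n : ℕ) (G : Graph (3 + n)) (σ : Fin (3 + n) → Fin (3 + n))
    → Bijective _≡_ _≡_ σ
    → (∀ i j → toℕ i ≤ toℕ j → degree G (σ j) ≤ degree G (σ i))
    → (k : ℕ) → 2 ≤ k → k ≤ 3 + n
    → (∀ i → 1 ≤ toℕ i → toℕ i < k → degree G (σ i) ≡ degree G (σ (suc zero)))
    → (∀ k′ → 2 ≤ k′ → k′ ≤ 3 + n
         → (∀ i → 1 ≤ toℕ i → toℕ i < k′ → degree G (σ i) ≡ degree G (σ (suc zero)))
         → k′ ≤ k)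
    → (3 + n) * degree G (σ (suc zero)) < 2 * edges G
    → (sumFin (3 + n) (λ i → if2 (toℕ i) (degree G (σ (suc zero)) ∸ degree G (σ i)))
         < degree G (σ zero) ∸ degree G (σ (suc zero)))
      × (degree G (σ (suc zero)) ≡ degree G (σ (suc (suc zero))))
      × (degree G (σ (suc zero)) + ((3 + n) ∸ k) < degree G (σ zero))
      × (degree G (σ (suc zero)) + (3 + n) + 1 ∸ degree G (σ zero) ≤ k)
      × (degree G (σ (suc zero)) + 2 ≤ degree G (σ (suc zero)) + (3 + n) + 1 ∸ degree G (σ zero))
lemma3p1 n G σ σ-bijective non-increasing k 2≤k k≤N plateau maximal below-average =
  sum-deficit<Δ₁∸Δ₂ , sym (plateau (suc (suc zero)) (s≤s z≤n) 3≤k) , Δ₂+[N∸k]<Δ₁ ,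
  m+[n∸k]<o⇒m+n+1∸o≤k Δ₂+[N∸k]<Δ₁ k≤N , o<n⇒m+2≤m+n+1∸o (degree<order G (σ zero))
  where
  open NonIncreasingSequence (degree G ∘ σ) non-increasing
  deficit-gap : sum deficit + Δ₂ < Δ₁
  deficit-gap = below-average⇒deficit-gap (subst ((3 + n) * Δ₂ <_)
    (sym (trans (sum-∘-bijective (degree G) σ σ-bijective) (handshake G))) below-average)
  sum-deficit<Δ₁∸Δ₂ : sumFin (3 + n) deficit < Δ₁ ∸ Δ₂
  sum-deficit<Δ₁∸Δ₂ = subst (_< Δ₁ ∸ Δ₂) (sym (sumFin≡sum (3 + n) deficit)) (m+n≤o⇒m≤o∸n _ deficit-gap)
  Δ₂+[N∸k]<Δ₁ : Δ₂ + (3 + n ∸ k) < Δ₁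
  Δ₂+[N∸k]<Δ₁ = ≤-<-trans (≤-trans (≤-reflexive (+-comm Δ₂ _))
    (+-monoˡ-≤ Δ₂ (tail-length≤sum-deficit 2≤k plateau maximal))) deficit-gap
  3≤k : 3 ≤ k
  3≤k = plateau-length≥3 G σ σ-bijective non-increasing 2≤k Δ₂+[N∸k]<Δ₁
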